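{- For every integer $n\ge 0$, \[ \binom{2n}{n}^2\sum_{k}\binom{n}{k}^2\binom{n+k}{n}=\binom{2n}{n}^2\sum_{k}\binom{n}{k}\binom{2k}{k}\binom{n+k}{n-k}=\binom{2n}{n}\sum_{k}\binom{n}{k}\binom{n+k}{n}\binom{2n-k}{n}\binom{2n}{k}, \] where all sums run over $k=0,\dots,n$.
   Context: $\binom{m}{j}$ is the usual binomial coefficient. -}

module Defs where

open import Data.Nat using (ℕ; zero; suc; _+_)

Σ₀ⁿ : ℕ → (ℕ → ℕ) → ℕ
Σ₀ⁿ zero    f = f 0
Σ₀ⁿ (suc n) f = Σ₀ⁿ n f + f (suc n)

-- Both identities hold summand by summand.  For k ≤ n the trinomial revision
-- C(a+b+c, a+b) C(a+b, a) = C(a+b+c, a) C(b+c, b), i.e. two ways of counting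
-- ordered splittings into blocks of sizes a, b, c, gives
--   C(n, k) C(n+k, n)     = C(2k, k) C(n+k, n-k)     (blocks n-k, k, k),
--   C(2n-k, n) C(2n, k)   = C(2n, n) C(n, k)         (blocks k, n-k, n),
-- so the k-th summands of the first and second sums agree, and C(2n, n) times
-- the k-th summand of the first sum is the k-th summand of the third.
module Submission where

open import Defs
open import Data.Nat using (ℕ; _+_; _*_; _∸_; _^_)
open import Data.Nat.Combinatorics using (_C_)
open import Data.Product using (_×_)
open import Relation.Binary.PropositionalEquality using (_≡_)

open import Data.Nat.Base using (zero; suc; _!; _≤_; z≤n)
open import Data.Nat.Properties
open import Data.Nat.DivMod using (_/_; m/n*n≡m)
open import Data.Nat.Combinatorics using (nCk≡nC[n∸k]; k![n∸k]!∣n!)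
open import Data.Nat.Combinatorics.Specification using (nCk≡n!/k![n-k]!)
open import Data.Nat.Solver using (module +-*-Solver)
open import Data.Product using (_,_)
open import Relation.Binary.PropositionalEquality using (refl; sym; trans; cong; cong₂; module ≡-Reasoning)
open +-*-Solver using (solve; _:*_; _:^_; _:=_)
open ≡-Reasoning

Σ₀ⁿ-cong : ∀ n {f g : ℕ → ℕ} → (∀ {k} → k ≤ n → f k ≡ g k) → Σ₀ⁿ n f ≡ Σ₀ⁿ n g
Σ₀ⁿ-cong zero    f≗g = f≗g z≤n
Σ₀ⁿ-cong (suc n) f≗g = cong₂ _+_ (Σ₀ⁿ-cong n (λ k≤n → f≗g (m≤n⇒m≤1+n k≤n))) (f≗g ≤-refl)

*-distribˡ-Σ₀ⁿ : ∀ c n (f : ℕ → ℕ) → c * Σ₀ⁿ n f ≡ Σ₀ⁿ n (λ k → c * f k)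
*-distribˡ-Σ₀ⁿ c zero    f = refl
*-distribˡ-Σ₀ⁿ c (suc n) f =
  trans (*-distribˡ-+ c (Σ₀ⁿ n f) (f (suc n))) (cong (_+ c * f (suc n)) (*-distribˡ-Σ₀ⁿ c n f))

m^2*n≡m*[m*n] : ∀ m n → m ^ 2 * n ≡ m * (m * n)
m^2*n≡m*[m*n] = solve 2 (λ m n → m :^ 2 :* n := m :* (m :* n)) refl

nCk*[k!*[n∸k]!]≡n! : ∀ {n k} → k ≤ n → (n C k) * (k ! * (n ∸ k) !) ≡ n !
nCk*[k!*[n∸k]!]≡n! {n} {k} k≤n = begin
  (n C k) * (k ! * (n ∸ k) !)                ≡⟨ cong (_* (k ! * (n ∸ k) !)) (nCk≡n!/k![n-k]! k≤n) ⟩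
  n ! / (k ! * (n ∸ k) !) * (k ! * (n ∸ k) !) ≡⟨ m/n*n≡m (k![n∸k]!∣n! k≤n) ⟩
  n !                                         ∎
  where instance _ = k !* (n ∸ k) !≢0

[m+n]Cm*[m!*n!]≡[m+n]! : ∀ m n → ((m + n) C m) * (m ! * n !) ≡ (m + n) !
[m+n]Cm*[m!*n!]≡[m+n]! m n =
  trans (cong (λ o → ((m + n) C m) * (m ! * o !)) (sym (m+n∸m≡n m n)))
        (nCk*[k!*[n∸k]!]≡n! (m≤m+n m n))

[m+n]Cm≡[m+n]Cn : ∀ m n → (m + n) C m ≡ (m + n) C n
[m+n]Cm≡[m+n]Cn m n =
  trans (nCk≡nC[n∸k] (m≤m+n m n)) (cong ((m + n) C_) (m+n∸m≡n m n))

[m+n+o]C[m+n]*[m+n]Cm≡[m+n+o]Cm*[n+o]Cn : ∀ m n o →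
  ((m + n + o) C (m + n)) * ((m + n) C m) ≡ ((m + n + o) C m) * ((n + o) C n)
[m+n+o]C[m+n]*[m+n]Cm≡[m+n+o]Cm*[n+o]Cn m n o =
  *-cancelʳ-≡ _ _ (m ! * n ! * o !) {{m*n≢0 _ _ {{m !* n !≢0}} {{o !≢0}}}} (begin
    ((m + n + o) C (m + n)) * ((m + n) C m) * (m ! * n ! * o !)
      ≡⟨ regroupˡ ((m + n + o) C (m + n)) ((m + n) C m) (m !) (n !) (o !) ⟩
    ((m + n + o) C (m + n)) * (((m + n) C m) * (m ! * n !) * o !)
      ≡⟨ cong (λ x → ((m + n + o) C (m + n)) * (x * o !)) ([m+n]Cm*[m!*n!]≡[m+n]! m n) ⟩
    ((m + n + o) C (m + n)) * ((m + n) ! * o !)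
      ≡⟨ [m+n]Cm*[m!*n!]≡[m+n]! (m + n) o ⟩
    (m + n + o) !
      ≡⟨ cong _! (+-assoc m n o) ⟩
    (m + (n + o)) !
      ≡⟨ sym ([m+n]Cm*[m!*n!]≡[m+n]! m (n + o)) ⟩
    ((m + (n + o)) C m) * (m ! * (n + o) !)
      ≡⟨ cong₂ (λ x y → (x C m) * (m ! * y)) (sym (+-assoc m n o)) (sym ([m+n]Cm*[m!*n!]≡[m+n]! n o)) ⟩
    ((m + n + o) C m) * (m ! * (((n + o) C n) * (n ! * o !)))
      ≡⟨ regroupʳ ((m + n + o) C m) ((n + o) C n) (m !) (n !) (o !) ⟩
    ((m + n + o) C m) * ((n + o) C n) * (m ! * n ! * o !) ∎)
  where
  regroupˡ : ∀ x y a b c → x * y * (a * b * c) ≡ x * (y * (a * b) * c)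
  regroupˡ = solve 5 (λ x y a b c → x :* y :* (a :* b :* c) := x :* (y :* (a :* b) :* c)) refl
  regroupʳ : ∀ x y a b c → x * (a * (y * (b * c))) ≡ x * y * (a * b * c)
  regroupʳ = solve 5 (λ x y a b c → x :* (a :* (y :* (b :* c))) := x :* y :* (a :* b :* c)) refl

nCk*[n+k]Cn≡[2k]Ck*[n+k]C[n∸k] : ∀ {n k} → k ≤ n →
  (n C k) * ((n + k) C n) ≡ ((2 * k) C k) * ((n + k) C (n ∸ k))
nCk*[n+k]Cn≡[2k]Ck*[n+k]C[n∸k] {k = k} k≤n with m≤n⇒∃[o]m+o≡n k≤n
... | d , refl = begin
  ((k + d) C k) * ((k + d + k) C (k + d))
    ≡⟨ cong₂ _*_ (trans ([m+n]Cm≡[m+n]Cn k d) (cong (_C d) (+-comm k d)))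
                 (cong (λ m → (m + k) C m) (+-comm k d)) ⟩
  ((d + k) C d) * ((d + k + k) C (d + k))
    ≡⟨ *-comm ((d + k) C d) _ ⟩
  ((d + k + k) C (d + k)) * ((d + k) C d)
    ≡⟨ [m+n+o]C[m+n]*[m+n]Cm≡[m+n+o]Cm*[n+o]Cn d k k ⟩
  ((d + k + k) C d) * ((k + k) C k)
    ≡⟨ *-comm ((d + k + k) C d) _ ⟩
  ((k + k) C k) * ((d + k + k) C d)
    ≡⟨ cong₂ _*_ (cong (λ m → (k + m) C k) (sym (+-identityʳ k)))
                 (cong₂ _C_ (cong (_+ k) (+-comm d k)) (sym (m+n∸m≡n k d))) ⟩
  ((2 * k) C k) * ((k + d + k) C (k + d ∸ k)) ∎

[2n∸k]Cn*[2n]Ck≡[2n]Cn*nCk : ∀ {n k} → k ≤ n →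
  ((2 * n ∸ k) C n) * ((2 * n) C k) ≡ ((2 * n) C n) * (n C k)
[2n∸k]Cn*[2n]Ck≡[2n]Cn*nCk {k = k} k≤n with m≤n⇒∃[o]m+o≡n k≤n
... | d , refl = begin
  ((2 * n ∸ k) C n) * ((2 * n) C k)
    ≡⟨ *-comm ((2 * n ∸ k) C n) _ ⟩
  ((2 * n) C k) * ((2 * n ∸ k) C n)
    ≡⟨ cong (λ m → (m C k) * ((m ∸ k) C n)) 2n≡n+n ⟩
  ((n + n) C k) * ((n + n ∸ k) C n)
    ≡⟨ cong (λ m → ((n + n) C k) * (m C n)) (trans (cong (_∸ k) (+-assoc k d n)) (m+n∸m≡n k (d + n))) ⟩
  ((n + n) C k) * ((d + n) C n)
    ≡⟨ cong (((n + n) C k) *_) (sym ([m+n]Cm≡[m+n]Cn d n)) ⟩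
  ((n + n) C k) * ((d + n) C d)
    ≡⟨ sym ([m+n+o]C[m+n]*[m+n]Cm≡[m+n+o]Cm*[n+o]Cn k d n) ⟩
  ((n + n) C n) * (n C k)
    ≡⟨ cong (λ m → (m C n) * (n C k)) (sym 2n≡n+n) ⟩
  ((2 * n) C n) * (n C k) ∎
  where
  n = k + d
  2n≡n+n : 2 * n ≡ n + n
  2n≡n+n = cong (n +_) (+-identityʳ n)

nCk^2*[n+k]Cn≡nCk*[2k]Ck*[n+k]C[n∸k] : ∀ {n k} → k ≤ n →
  (n C k) ^ 2 * ((n + k) C n) ≡ (n C k) * ((2 * k) C k) * ((n + k) C (n ∸ k))
nCk^2*[n+k]Cn≡nCk*[2k]Ck*[n+k]C[n∸k] {n} {k} k≤n = begin
  (n C k) ^ 2 * ((n + k) C n)                     ≡⟨ m^2*n≡m*[m*n] (n C k) _ ⟩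
  (n C k) * ((n C k) * ((n + k) C n))             ≡⟨ cong ((n C k) *_) (nCk*[n+k]Cn≡[2k]Ck*[n+k]C[n∸k] k≤n) ⟩
  (n C k) * (((2 * k) C k) * ((n + k) C (n ∸ k))) ≡⟨ *-assoc (n C k) _ _ ⟨
  (n C k) * ((2 * k) C k) * ((n + k) C (n ∸ k))   ∎

[2n]Cn*nCk^2*[n+k]Cn≡nCk*[n+k]Cn*[2n∸k]Cn*[2n]Ck : ∀ {n k} → k ≤ n →
  ((2 * n) C n) * ((n C k) ^ 2 * ((n + k) C n))
    ≡ (n C k) * ((n + k) C n) * ((2 * n ∸ k) C n) * ((2 * n) C k)
[2n]Cn*nCk^2*[n+k]Cn≡nCk*[n+k]Cn*[2n∸k]Cn*[2n]Ck {n} {k} k≤n = begin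
  ((2 * n) C n) * ((n C k) ^ 2 * ((n + k) C n))
    ≡⟨ regroup ((2 * n) C n) (n C k) ((n + k) C n) ⟩
  (n C k) * ((n + k) C n) * (((2 * n) C n) * (n C k))
    ≡⟨ cong ((n C k) * ((n + k) C n) *_) ([2n∸k]Cn*[2n]Ck≡[2n]Cn*nCk k≤n) ⟨
  (n C k) * ((n + k) C n) * (((2 * n ∸ k) C n) * ((2 * n) C k))
    ≡⟨ *-assoc ((n C k) * ((n + k) C n)) _ _ ⟨
  (n C k) * ((n + k) C n) * ((2 * n ∸ k) C n) * ((2 * n) C k) ∎
  where
  regroup : ∀ c x y → c * (x ^ 2 * y) ≡ x * y * (c * x)
  regroup = solve 3 (λ c x y → c :* (x :^ 2 :* y) := x :* y :* (c :* x)) refl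

mainTheorem12 : ∀ (n : ℕ) →
    ((2 * n) C n) ^ 2 * Σ₀ⁿ n (λ k → (n C k) ^ 2 * ((n + k) C n))
      ≡ ((2 * n) C n) ^ 2 * Σ₀ⁿ n (λ k → (n C k) * ((2 * k) C k) * ((n + k) C (n ∸ k)))
    × ((2 * n) C n) ^ 2 * Σ₀ⁿ n (λ k → (n C k) * ((2 * k) C k) * ((n + k) C (n ∸ k)))
      ≡ ((2 * n) C n) * Σ₀ⁿ n (λ k → (n C k) * ((n + k) C n) * (((2 * n) ∸ k) C n) * ((2 * n) C k))
mainTheorem12 n = cong (c ^ 2 *_) first≡second , (begin
  c ^ 2 * second           ≡⟨ cong (c ^ 2 *_) first≡second ⟨
  c ^ 2 * first            ≡⟨ m^2*n≡m*[m*n] c first ⟩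
  c * (c * first)          ≡⟨ cong (c *_) (*-distribˡ-Σ₀ⁿ c n _) ⟩
  c * Σ₀ⁿ n (λ k → c * a k) ≡⟨ cong (c *_) (Σ₀ⁿ-cong n [2n]Cn*nCk^2*[n+k]Cn≡nCk*[n+k]Cn*[2n∸k]Cn*[2n]Ck) ⟩
  c * third                ∎)
  where
  c : ℕ
  c = (2 * n) C n
  a : ℕ → ℕ
  a k = (n C k) ^ 2 * ((n + k) C n)
  first second third : ℕ
  first  = Σ₀ⁿ n a
  second = Σ₀ⁿ n (λ k → (n C k) * ((2 * k) C k) * ((n + k) C (n ∸ k)))
  third  = Σ₀ⁿ n (λ k → (n C k) * ((n + k) C n) * (((2 * n) ∸ k) C n) * ((2 * n) C k))
  first≡second : first ≡ second
  first≡second = Σ₀ⁿ-cong n nCk^2*[n+k]Cn≡nCk*[2k]Ck*[n+k]C[n∸k]
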